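{- Let ${\cal G}$ be a graph model and let $M,N$ be closed $\lambda$-terms with $\alpha\in M^{\cal G}\setminus N^{\cal G}$. Then there exists a finite partial pair ${\cal A}\le{\cal G}$ such that for every partial pair ${\cal C}\ge{\cal A}$, if there is a morphism $f:{\cal C}\to{\cal G}$ with $f(\alpha)=\alpha$, then $\alpha\in M^{\cal C}\setminus N^{\cal C}$.
   Context: A partial pair is ${\cal A}=(A,c_{\cal A})$ with $A$ a set and $c_{\cal A}:A^*\times A\rightharpoonup A$ partial injective ($A^*$ = finite subsets); it is finite if $A$ is finite; a graph model is a partial pair with $A$ infinite and $c_{\cal A}$ total. Interpretation in a partial pair for $\rho:Var\to{\cal P}(A)$: $x_\rho=\rho(x)$; $(MN)_\rho=\{\alpha\in A:\exists a\subseteq N_\rho\text{ finite},(a,\alpha)\in dom(c_{\cal A}), c_{\cal A}(a,\alpha)\in M_\rho\}$; $(\lambda x.M)_\rho=\{c_{\cal A}(a,\alpha):(a,\alpha)\in dom(c_{\cal A}),\alpha\in M_{\rho[x:=a]}\}$; $M^{\cal A}$ for closed $M$. ${\cal A}\le{\cal B}$ ($\cal A$ is a subpair of ${\cal B}$) means $A\subseteq B$ and $c_{\cal B}(a,\alpha)=c_{\cal A}(a,\alpha)$ for all $(a,\alpha)\in dom(c_{\cal A})$. A morphism $f:{\cal A}\to{\cal B}$ is a map $f:A\to B$ such that $(a,\alpha)\in dom(c_{\cal A})$ implies $(f[a],f(\alpha))\in dom(c_{\cal B})$ and $f(c_{\cal A}(a,\alpha))=c_{\cal B}(f[a],f(\alpha))$.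 -}

module Defs where

open import Data.Nat using (ℕ; suc)
open import Data.Fin using (Fin; zero; suc)
open import Data.List using (List; map)
open import Data.List.Membership.Propositional using (_∈_; _∉_)
open import Data.List.Relation.Unary.All using (All)
open import Data.Product using (Σ; _×_; _,_)
open import Data.Empty using (⊥)
open import Function.Bundles using (_⇔_)
open import Relation.Binary.PropositionalEquality using (_≡_)

-- A finite list a : List T is read as the finite set {t | t ∈ a}.
SameSet : {T : Set} → List T → List T → Set
SameSet a b = ∀ t → (t ∈ a) ⇔ (t ∈ b)

-- In t        : t belongs to the carrier A
--   Rel a α β   : (a , α) ∈ dom(c) and c(a , α) = β
-- c is a partial function A* × A ⇀ A on finite *sets* (so Rel respects
-- set-equality of lists), it is functional, and it is injective.
record PartialPair (T : Set) : Set₁ where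
  field
    In         : T → Set
    Rel        : List T → T → T → Set
    closed     : ∀ {a α β} → Rel a α β → All In a × In α × In β
    respects   : ∀ {a a′ α β} → SameSet a a′ → Rel a α β → Rel a′ α β
    functional : ∀ {a α β β′} → Rel a α β → Rel a α β′ → β ≡ β′
    injective  : ∀ {a a′ α α′ β} → Rel a α β → Rel a′ α′ β →
                 SameSet a a′ × α ≡ α′
open PartialPair public

Finite : {T : Set} → PartialPair T → Set
Finite {T} 𝒜 = Σ (List T) λ l → ∀ t → In 𝒜 t ⇔ (t ∈ l)

Infinite : {T : Set} → PartialPair T → Set
Infinite {T} 𝒜 = ∀ (l : List T) → Σ T λ t → In 𝒜 t × t ∉ l

Total : {T : Set} → PartialPair T → Set
Total {T} 𝒜 = ∀ (a : List T) (α : T) → All (In 𝒜) a → In 𝒜 α →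
              Σ T λ β → Rel 𝒜 a α β

GraphModel : {T : Set} → PartialPair T → Set
GraphModel 𝒢 = Infinite 𝒢 × Total 𝒢

-- 𝒜 ≤ ℬ, where the carrier of 𝒜 is included in that of ℬ along the
-- (injective) inclusion map e of the ambient types.
SubpairVia : {T T′ : Set} → (T → T′) → PartialPair T → PartialPair T′ → Set
SubpairVia {T} e 𝒜 ℬ =
  (∀ t → In 𝒜 t → In ℬ (e t)) ×
  (∀ (a : List T) α β → Rel 𝒜 a α β → Rel ℬ (map e a) (e α) (e β))

_≤ₚ_ : {T : Set} → PartialPair T → PartialPair T → Set
𝒜 ≤ₚ ℬ = SubpairVia (λ t → t) 𝒜 ℬ

-- f is a morphism 𝒜 → ℬ (f given on the ambient type; only its
-- behaviour on the carrier of 𝒜 matters)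
Morphism : {T T′ : Set} → PartialPair T → PartialPair T′ → (T → T′) → Set
Morphism {T} 𝒜 ℬ f =
  (∀ t → In 𝒜 t → In ℬ (f t)) ×
  (∀ (a : List T) α β → Rel 𝒜 a α β → Rel ℬ (map f a) (f α) (f β))

data Term (n : ℕ) : Set where
  var : Fin n → Term n
  app : Term n → Term n → Term n
  lam : Term (suc n) → Term n

Env : Set → ℕ → Set₁
Env T n = Fin n → (T → Set)

extend : {T : Set} {n : ℕ} → Env T n → (T → Set) → Env T (suc n)
extend ρ X zero    = X
extend ρ X (suc i) = ρ i

⟦_⟧ : {T : Set} {n : ℕ} → Term n → PartialPair T → Env T n → T → Set
⟦ var i   ⟧ 𝒜 ρ t = ρ i t
⟦_⟧ {T} (app M N) 𝒜 ρ t =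
  Σ (List T) λ a → All (⟦ N ⟧ 𝒜 ρ) a × Σ T λ β → Rel 𝒜 a t β × ⟦ M ⟧ 𝒜 ρ β
⟦_⟧ {T} (lam M) 𝒜 ρ t =
  Σ (List T) λ a → Σ T λ α → Rel 𝒜 a α t × ⟦ M ⟧ 𝒜 (extend ρ (λ x → x ∈ a)) α

emptyEnv : {T : Set} → Env T 0
emptyEnv ()

⟦_⟧ᶜ : {T : Set} → Term 0 → PartialPair T → T → Set
⟦ M ⟧ᶜ 𝒜 = ⟦ M ⟧ 𝒜 emptyEnv

{-# OPTIONS --safe #-}
module Submission where

-- Interpretation is defined positively, so it is carried forward along any map
-- preserving the graph of c: from 𝒜 ≤ 𝒞 we get α ∈ M^𝒞, and from the
-- morphism 𝒞 → 𝒢 fixing α, α ∈ N^𝒞 would give α ∈ N^𝒢. It remains to take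
-- for 𝒜 the finite subpair generated by the finitely many instances
-- c(a, α′) = β used to witness α ∈ M^𝒢.

open import Defs
open import Data.Sum using (_⊎_; inj₁)
open import Data.Product using (Σ; ∃; _×_; _,_; proj₁; proj₂)
open import Relation.Nullary using (¬_)
open import Relation.Binary.PropositionalEquality using (_≡_; refl; subst; sym)
open import Data.Nat using (ℕ)
open import Data.Fin using (zero; suc)
open import Data.List using (List; []; _∷_; _++_; map; concatMap)
open import Data.List.Properties using (map-id)
open import Data.List.Membership.Propositional using (_∈_; lose)
open import Data.List.Membership.Propositional.Properties
  using (∈-map⁺; ∈-concatMap⁺; ∈-concatMap⁻)
open import Data.List.Relation.Binary.Subset.Propositional using (_⊆_)
open import Data.List.Relation.Binary.Subset.Propositional.Properties
  using (xs⊆xs++ys; xs⊆ys++xs)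
open import Data.List.Relation.Unary.Any using (here; there; satisfied)
open import Data.List.Relation.Unary.All as All using (All; []; _∷_)
open import Data.List.Relation.Unary.All.Properties using (map⁺)
open import Function.Base using (_∘_)
open import Function.Bundles using (mk⇔; Equivalence)

RelPreserving : {T T′ : Set} → (T → T′) → PartialPair T → PartialPair T′ → Set
RelPreserving {T} f 𝒜 ℬ =
  ∀ (a : List T) α β → Rel 𝒜 a α β → Rel ℬ (map f a) (f α) (f β)

Rel-map-id : {T : Set} {𝒜 : PartialPair T} {a : List T} {α β : T} →
             Rel 𝒜 a α β → Rel 𝒜 (map (λ t → t) a) α β
Rel-map-id {𝒜 = 𝒜} {a} {α} {β} = subst (λ b → Rel 𝒜 b α β) (sym (map-id a))

⟦⟧-transport : {T T′ : Set} {𝒜 : PartialPair T} {ℬ : PartialPair T′} {f : T → T′} →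
               RelPreserving f 𝒜 ℬ →
               {n : ℕ} (M : Term n) {ρ : Env T n} {ρ′ : Env T′ n} →
               (∀ i {t} → ρ i t → ρ′ i (f t)) →
               ∀ {t} → ⟦ M ⟧ 𝒜 ρ t → ⟦ M ⟧ ℬ ρ′ (f t)
⟦⟧-transport pres (var i) ρ⇒ρ′ t∈ = ρ⇒ρ′ i t∈
⟦⟧-transport {f = f} pres (app M N) ρ⇒ρ′ {t} (a , Na , β , r , Mβ) =
  map f a , map⁺ (All.map (⟦⟧-transport pres N ρ⇒ρ′) Na) ,
  f β , pres a t β r , ⟦⟧-transport pres M ρ⇒ρ′ Mβ
⟦⟧-transport {f = f} pres (lam M) ρ⇒ρ′ {t} (a , α , r , Mα) =
  map f a , f α , pres a α t r , ⟦⟧-transport pres M extend⇒extend Mα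
  where
  extend⇒extend : ∀ i {s} → extend _ (_∈ a) i s → extend _ (_∈ map f a) i (f s)
  extend⇒extend zero    = ∈-map⁺ f
  extend⇒extend (suc i) = ρ⇒ρ′ i

⟦⟧ᶜ-transport : {T T′ : Set} {𝒜 : PartialPair T} {ℬ : PartialPair T′} {f : T → T′} →
                RelPreserving f 𝒜 ℬ →
                (M : Term 0) → ∀ {t} → ⟦ M ⟧ᶜ 𝒜 t → ⟦ M ⟧ᶜ ℬ (f t)
⟦⟧ᶜ-transport pres M = ⟦⟧-transport pres M (λ ())

All-∃⇒∃-All : {A B : Set} {P : List B → A → Set} →
              (∀ {W W′} → W ⊆ W′ → ∀ {x} → P W x → P W′ x) →
              {Q : A → Set} → (∀ {x} → Q x → ∃ λ W → P W x) →
              ∀ {xs} → All Q xs → ∃ λ W → All (P W) xs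
All-∃⇒∃-All mono bound [] = [] , []
All-∃⇒∃-All mono bound (Qx ∷ Qxs) with bound Qx | All-∃⇒∃-All mono bound Qxs
... | W₁ , Px | W₂ , Pxs =
  W₁ ++ W₂ , mono (xs⊆xs++ys W₁ W₂) Px ∷ All.map (mono (xs⊆ys++xs W₂ W₁)) Pxs

module Generated {U : Set} (𝒢 : PartialPair U) where

  Triple : Set
  Triple = Σ (List U) λ a → Σ U λ α → Σ U λ β → Rel 𝒢 a α β

  points : Triple → List U
  points (a , α , β , _) = β ∷ α ∷ a

  value : Triple → U
  value (_ , _ , β , _) = β

  support : List Triple → List U
  support = concatMap points

  ∈-support : ∀ {W w t} → w ∈ W → t ∈ points w → t ∈ support W
  ∈-support w∈W t∈w = ∈-concatMap⁺ points (lose w∈W t∈w)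

  points-In : ∀ w {t} → t ∈ points w → In 𝒢 t
  points-In (_ , _ , _ , r) (here refl)         = proj₂ (proj₂ (closed 𝒢 r))
  points-In (_ , _ , _ , r) (there (here refl)) = proj₁ (proj₂ (closed 𝒢 r))
  points-In (_ , _ , _ , r) (there (there t∈a)) = All.lookup (proj₁ (closed 𝒢 r)) t∈a

  RelGenerated : List Triple → List U → U → U → Set
  RelGenerated W a α β = Rel 𝒢 a α β × ∃ λ w → w ∈ W × value w ≡ β

  -- Only the value is restricted: injectivity of c then puts the arguments
  -- among the points of W as well.
  RelGenerated-closed : ∀ {W a α β} → RelGenerated W a α β →
                        All (_∈ support W) a × α ∈ support W × β ∈ support W
  RelGenerated-closed (r , w@(_ , _ , _ , r₀) , w∈W , refl) with injective 𝒢 r r₀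
  ... | a≐a₀ , refl =
    All.tabulate (λ t∈a → ∈-support w∈W (there (there (Equivalence.to (a≐a₀ _) t∈a)))) ,
    ∈-support w∈W (there (here refl)) , ∈-support w∈W (here refl)

  generated : List Triple → PartialPair U
  generated W = record
    { In         = _∈ support W
    ; Rel        = RelGenerated W
    ; closed     = RelGenerated-closed
    ; respects   = λ a≐a′ (r , v) → respects 𝒢 a≐a′ r , v
    ; functional = λ (r , _) (r′ , _) → functional 𝒢 r r′
    ; injective  = λ (r , _) (r′ , _) → injective 𝒢 r r′
    }

  generated-finite : ∀ W → Finite (generated W)
  generated-finite W = support W , λ _ → mk⇔ (λ t∈ → t∈) (λ t∈ → t∈)

  generated-≤ : ∀ W → generated W ≤ₚ 𝒢
  generated-≤ W = (λ t → support-In) , (λ a α β (r , _) → Rel-map-id {𝒜 = 𝒢} r)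
    where
    support-In : ∀ {t} → t ∈ support W → In 𝒢 t
    support-In t∈ with satisfied (∈-concatMap⁻ points {W} t∈)
    ... | w , t∈w = points-In w t∈w

  ⟦⟧-generated-mono : ∀ {W W′} → W ⊆ W′ →
                      {n : ℕ} (M : Term n) {ρ : Env U n} →
                      ∀ {t} → ⟦ M ⟧ (generated W) ρ t → ⟦ M ⟧ (generated W′) ρ t
  ⟦⟧-generated-mono {W′ = W′} W⊆W′ M =
    ⟦⟧-transport (λ a α β (r , w , w∈W , v) → Rel-map-id {𝒜 = generated W′} (r , w , W⊆W′ w∈W , v))
                 M (λ i t∈ → t∈)

  ⟦⟧-finite-support : {n : ℕ} (M : Term n) {ρ : Env U n} →
                      ∀ {t} → ⟦ M ⟧ 𝒢 ρ t → ∃ λ W → ⟦ M ⟧ (generated W) ρ t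
  ⟦⟧-finite-support (var i) t∈ = [] , t∈
  ⟦⟧-finite-support (app M N) {t = t} (a , Na , β , r , Mβ)
    with All-∃⇒∃-All (λ W⊆W′ → ⟦⟧-generated-mono W⊆W′ N) (⟦⟧-finite-support N) Na
       | ⟦⟧-finite-support M Mβ
  ... | Wₙ , Na′ | Wₘ , Mβ′ =
    w ∷ Wₙ ++ Wₘ ,
    a , All.map (⟦⟧-generated-mono (there ∘ xs⊆xs++ys Wₙ Wₘ) N) Na′ ,
    β , (r , w , here refl , refl) , ⟦⟧-generated-mono (there ∘ xs⊆ys++xs Wₘ Wₙ) M Mβ′
    where w = a , t , β , r
  ⟦⟧-finite-support (lam M) {t = t} (a , α , r , Mα) with ⟦⟧-finite-support M Mα
  ... | W , Mα′ =
    w ∷ W , a , α , (r , w , here refl , refl) , ⟦⟧-generated-mono there M Mα′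
    where w = a , α , t , r

open Generated

proposition2 : (U : Set) (𝒢 : PartialPair U) → GraphModel 𝒢 →
               (M N : Term 0) (α : U) →
               ⟦ M ⟧ᶜ 𝒢 α → ¬ ⟦ N ⟧ᶜ 𝒢 α →
               Σ (PartialPair U) λ 𝒜 → Finite 𝒜 × 𝒜 ≤ₚ 𝒢 ×
                 ((X : Set) (𝒞 : PartialPair (U ⊎ X)) →
                  SubpairVia inj₁ 𝒜 𝒞 →
                  (f : U ⊎ X → U) → Morphism 𝒞 𝒢 f →
                  In 𝒞 (inj₁ α) → f (inj₁ α) ≡ α →
                  ⟦ M ⟧ᶜ 𝒞 (inj₁ α) × ¬ ⟦ N ⟧ᶜ 𝒞 (inj₁ α))
proposition2 U 𝒢 _ M N α Mα ¬Nα with ⟦⟧-finite-support 𝒢 M Mα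
... | W , Mα′ =
  generated 𝒢 W , generated-finite 𝒢 W , generated-≤ 𝒢 W ,
  λ X 𝒞 (_ , inj₁-pres) f (_ , f-pres) _ fα≡α →
    ⟦⟧ᶜ-transport inj₁-pres M Mα′ ,
    λ Nα → ¬Nα (subst (⟦ N ⟧ᶜ 𝒢) fα≡α (⟦⟧ᶜ-transport f-pres N Nα))
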